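{- Let $s_1,s_2,s_3,s_4$ be nonnegative integers. Then the series $$\sum_{m,n=1}^\infty \frac{1}{m^{s_1}n^{s_2}(m+n)^{s_3}(m+2n)^{s_4}}$$ converges if and only if $s_1+s_3+s_4>1$, $s_2+s_3+s_4>1$, and $s_1+s_2+s_3+s_4>2$. -}

module Defs where

open import Data.Nat using (ℕ; zero; suc; _+_; _*_; _^_; NonZero)
open import Data.Nat.Properties using (m*n≢0; m^n≢0)
open import Data.Integer using (+_)
open import Data.Rational using (ℚ; _/_; 0ℚ) renaming (_+_ to _+ℚ_)

denom : (s₁ s₂ s₃ s₄ m n : ℕ) → ℕ
denom s₁ s₂ s₃ s₄ m n = m ^ s₁ * n ^ s₂ * (m + n) ^ s₃ * (m + 2 * n) ^ s₄

denom≢0 : ∀ s₁ s₂ s₃ s₄ i j → NonZero (denom s₁ s₂ s₃ s₄ (suc i) (suc j))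
denom≢0 s₁ s₂ s₃ s₄ i j =
  m*n≢0 (m ^ s₁ * n ^ s₂ * (m + n) ^ s₃) ((m + 2 * n) ^ s₄)
    {{m*n≢0 (m ^ s₁ * n ^ s₂) ((m + n) ^ s₃)
       {{m*n≢0 (m ^ s₁) (n ^ s₂) {{m^n≢0 m s₁}} {{m^n≢0 n s₂}}}}
       {{m^n≢0 (m + n) s₃}}}}
    {{m^n≢0 (m + 2 * n) s₄}}
  where
  m = suc i
  n = suc j

-- The summand 1 / (m^s1 n^s2 (m+n)^s3 (m+2n)^s4) at m = i+1, n = j+1.
term : (s₁ s₂ s₃ s₄ i j : ℕ) → ℚ
term s₁ s₂ s₃ s₄ i j =
  _/_ (+ 1) (denom s₁ s₂ s₃ s₄ (suc i) (suc j)) {{denom≢0 s₁ s₂ s₃ s₄ i j}}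

sumTo : ℕ → (ℕ → ℚ) → ℚ
sumTo zero    f = 0ℚ
sumTo (suc N) f = sumTo N f +ℚ f N

partialSum : (s₁ s₂ s₃ s₄ N : ℕ) → ℚ
partialSum s₁ s₂ s₃ s₄ N = sumTo N (λ i → sumTo N (λ j → term s₁ s₂ s₃ s₄ i j))

-- A double series of nonnegative terms converges iff its partial sums are bounded.
Converges : (s₁ s₂ s₃ s₄ : ℕ) → Set
Converges s₁ s₂ s₃ s₄ = ∃ λ (B : ℚ) → ∀ N → partialSum s₁ s₂ s₃ s₄ N Data.Rational.≤ B
  where open import Data.Product using (∃)

{-# OPTIONS --safe #-}
-- Convergence: under the three conditions the denominator is at least m n (m + n) / 2 (it suffices
-- to check the five minimal exponent patterns), and 1/(mn(m+n)) = 1/(m(m+n)²) + 1/(n(m+n)²).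
-- Comparing 1/(m(m+n)²) with 1/(m(m+n-1)(m+n)), each row telescopes to at most 1/m², and
-- 1/m² ≤ 2/(m(m+1)) telescopes again, so all partial sums stay below 8.
-- Divergence: if s₁+s₃+s₄ ≤ 1 the column n = 1 alone dominates Σ 1/(3m); if s₂+s₃+s₄ ≤ 1 the
-- row m = 1 dominates Σ 1/(3n); if s₁+s₂+s₃+s₄ ≤ 2 the m terms with n ≤ m in row m are each at
-- least 1/(9m²), giving Σ 1/(9m). Harmonic sums are unbounded by Oresme's doubling argument.
module Submission where

open import Defs

module Fraction where

  open import Data.Nat as ℕ using (suc; NonZero; z≤n; _*_)
  import Data.Nat.Properties as ℕ
  open import Data.Nat.Tactic.RingSolver using (solve-∀)
  open import Data.Integer as ℤ using (+_)
  import Data.Integer.Properties as ℤ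
  open import Data.Rational using (_/_; _≤_; _+_; 0ℚ; toℚᵘ)
  open import Data.Rational.Properties
  import Data.Rational.Unnormalised as ℚᵘ
  import Data.Rational.Unnormalised.Properties as ℚᵘ
  open import Relation.Binary.PropositionalEquality

  toℚᵘ-/ : ∀ i d .{{_ : NonZero d}} → toℚᵘ (i / d) ℚᵘ.≃ i ℚᵘ./ d
  toℚᵘ-/ i (suc d) = toℚᵘ-fromℚᵘ (i ℚᵘ./ suc d)

  cross≤⇒/≤ : ∀ a d b e .{{_ : NonZero d}} .{{_ : NonZero e}} → a * e ℕ.≤ b * d → + a / d ≤ + b / e
  cross≤⇒/≤ a d@(suc _) b e@(suc _) ae≤bd = toℚᵘ-cancel-≤
    (ℚᵘ.≤-respˡ-≃ (ℚᵘ.≃-sym (toℚᵘ-/ (+ a) d)) (ℚᵘ.≤-respʳ-≃ (ℚᵘ.≃-sym (toℚᵘ-/ (+ b) e))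
      (ℚᵘ.*≤* (subst₂ ℤ._≤_ (ℤ.pos-* a e) (ℤ.pos-* b d) (ℤ.+≤+ ae≤bd)))))

  cross≡⇒/≡ : ∀ a d b e .{{_ : NonZero d}} .{{_ : NonZero e}} → a * e ≡ b * d → + a / d ≡ + b / e
  cross≡⇒/≡ a d b e ae≡bd =
    ≤-antisym (cross≤⇒/≤ a d b e (ℕ.≤-reflexive ae≡bd)) (cross≤⇒/≤ b e a d (ℕ.≤-reflexive (sym ae≡bd)))

  /-+ : ∀ a d b e .{{_ : NonZero d}} .{{_ : NonZero e}} →
        + a / d + + b / e ≡ (+ (a * e ℕ.+ b * d) / (d * e)) {{ℕ.m*n≢0 d e}}
  /-+ a d@(suc _) b e@(suc _) = toℚᵘ-injective (ℚᵘ.≃-trans (toℚᵘ-homo-+ (+ a / d) (+ b / e))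
    (ℚᵘ.≃-trans (ℚᵘ.+-cong (toℚᵘ-/ (+ a) d) (toℚᵘ-/ (+ b) e))
    (ℚᵘ.≃-trans (ℚᵘ.≃-reflexive (ℚᵘ./-cong numerator refl)) (ℚᵘ.≃-sym (toℚᵘ-/ _ (d * e))))))
    where
    numerator : + a ℤ.* + e ℤ.+ + b ℤ.* + d ≡ + (a * e ℕ.+ b * d)
    numerator = sym (trans (ℤ.pos-+ (a * e) (b * d)) (cong₂ ℤ._+_ (ℤ.pos-* a e) (ℤ.pos-* b d)))

  0≤/ : ∀ a d .{{_ : NonZero d}} → 0ℚ ≤ + a / d
  0≤/ a d = cross≤⇒/≤ 0 1 a d z≤n

  /-suc : ∀ a d .{{_ : NonZero d}} → + a / d + + 1 / d ≡ + suc a / d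
  /-suc a d = trans (/-+ a d 1 d) (cross≡⇒/≡ (a * d ℕ.+ 1 * d) (d * d) (suc a) d {{ℕ.m*n≢0 d d}} (eq a d))
    where
    eq : ∀ a d → (a * d ℕ.+ 1 * d) * d ≡ (1 ℕ.+ a) * (d * d)
    eq = solve-∀

  1/-antimono-≤ : ∀ a b .{{_ : NonZero a}} .{{_ : NonZero b}} → b ℕ.≤ a → + 1 / a ≤ + 1 / b
  1/-antimono-≤ a b b≤a = cross≤⇒/≤ 1 a 1 b (ℕ.*-monoʳ-≤ 1 b≤a)

  1/-partialFraction : ∀ a b c .{{_ : NonZero a}} .{{_ : NonZero b}} .{{_ : NonZero c}} →
                       (b ℕ.+ c) * a ≡ b * c → + 1 / a ≡ + 1 / b + + 1 / c
  1/-partialFraction a b c [b+c]a≡bc = sym (trans (/-+ 1 b 1 c)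
    (cross≡⇒/≡ (1 * c ℕ.+ 1 * b) (b * c) 1 a {{ℕ.m*n≢0 b c}} (begin
      (1 * c ℕ.+ 1 * b) * a   ≡⟨ cong (_* a) (numerator b c) ⟩
      (b ℕ.+ c) * a           ≡⟨ [b+c]a≡bc ⟩
      b * c                   ≡⟨ ℕ.*-identityˡ (b * c) ⟨
      1 * (b * c)             ∎)))
    where
    open ≡-Reasoning
    numerator : ∀ b c → 1 * c ℕ.+ 1 * b ≡ b ℕ.+ c
    numerator = solve-∀

  1/-≤-twice : ∀ d e .{{_ : NonZero d}} .{{_ : NonZero e}} → d ℕ.≤ 2 * e → + 1 / e ≤ + 1 / d + + 1 / d
  1/-≤-twice d e d≤2e = begin
    + 1 / e                           ≡⟨ 1/-partialFraction e (2 * e) (2 * e) (halves e) ⟩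
    + 1 / (2 * e) + + 1 / (2 * e)     ≤⟨ +-mono-≤ (1/-antimono-≤ (2 * e) d d≤2e) (1/-antimono-≤ (2 * e) d d≤2e) ⟩
    + 1 / d + + 1 / d                 ∎
    where
    open ≤-Reasoning
    instance
      twice-e≢0 : NonZero (2 * e)
      twice-e≢0 = ℕ.m*n≢0 2 e
    halves : ∀ e → (2 * e ℕ.+ 2 * e) * e ≡ 2 * e * (2 * e)
    halves = solve-∀

module FiniteSum where

  open import Algebra.Bundles using (CommutativeMonoid)
  open import Data.Nat as ℕ using (ℕ; zero; suc; NonZero)
  import Data.Nat.Properties as ℕ
  open import Data.Integer using (+_)
  open import Data.Rational using (ℚ; _/_; _≤_; _+_; 0ℚ)
  open import Data.Rational.Properties
  open import Relation.Binary.PropositionalEquality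
  open import Algebra.Properties.CommutativeSemigroup
    (CommutativeMonoid.commutativeSemigroup +-0-commutativeMonoid) using (interchange)
  open Fraction using (cross≡⇒/≡; /-suc)

  p≤p+q : ∀ {p q} → 0ℚ ≤ q → p ≤ p + q
  p≤p+q {p} 0≤q = subst (_≤ p + _) (+-identityʳ p) (+-monoʳ-≤ p 0≤q)

  sumTo-cong : ∀ N {f g : ℕ → ℚ} → (∀ i → f i ≡ g i) → sumTo N f ≡ sumTo N g
  sumTo-cong zero    f≡g = refl
  sumTo-cong (suc N) f≡g = cong₂ _+_ (sumTo-cong N f≡g) (f≡g N)

  sumTo-mono-≤ : ∀ N {f g : ℕ → ℚ} → (∀ i → i ℕ.< N → f i ≤ g i) → sumTo N f ≤ sumTo N g
  sumTo-mono-≤ zero    f≤g = ≤-refl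
  sumTo-mono-≤ (suc N) f≤g = +-mono-≤ (sumTo-mono-≤ N (λ i i<N → f≤g i (ℕ.m<n⇒m<1+n i<N))) (f≤g N ℕ.≤-refl)

  sumTo-nonNeg : ∀ N {f : ℕ → ℚ} → (∀ i → 0ℚ ≤ f i) → 0ℚ ≤ sumTo N f
  sumTo-nonNeg zero    0≤f = ≤-refl
  sumTo-nonNeg (suc N) 0≤f = +-mono-≤ (sumTo-nonNeg N 0≤f) (0≤f N)

  sumTo-distrib-+ : ∀ N (f g : ℕ → ℚ) → sumTo N (λ i → f i + g i) ≡ sumTo N f + sumTo N g
  sumTo-distrib-+ zero    f g = refl
  sumTo-distrib-+ (suc N) f g = trans (cong (_+ (f N + g N)) (sumTo-distrib-+ N f g))
    (interchange (sumTo N f) (sumTo N g) (f N) (g N))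

  sumTo-zero : ∀ N → sumTo N (λ _ → 0ℚ) ≡ 0ℚ
  sumTo-zero zero    = refl
  sumTo-zero (suc N) = cong (_+ 0ℚ) (sumTo-zero N)

  sumTo-comm : ∀ N M (f : ℕ → ℕ → ℚ) →
               sumTo N (λ i → sumTo M (f i)) ≡ sumTo M (λ j → sumTo N (λ i → f i j))
  sumTo-comm zero    M f = sym (sumTo-zero M)
  sumTo-comm (suc N) M f = trans (cong (_+ sumTo M (f N)) (sumTo-comm N M f))
    (sym (sumTo-distrib-+ M (λ j → sumTo N (λ i → f i j)) (f N)))

  sumTo-+ : ∀ a b (f : ℕ → ℚ) → sumTo (a ℕ.+ b) f ≡ sumTo a f + sumTo b (λ i → f (a ℕ.+ i))
  sumTo-+ a zero    f = trans (cong (λ k → sumTo k f) (ℕ.+-identityʳ a)) (sym (+-identityʳ (sumTo a f)))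
  sumTo-+ a (suc b) f = begin
    sumTo (a ℕ.+ suc b) f                                 ≡⟨ cong (λ k → sumTo k f) (ℕ.+-suc a b) ⟩
    sumTo (a ℕ.+ b) f + f (a ℕ.+ b)                       ≡⟨ cong (_+ f (a ℕ.+ b)) (sumTo-+ a b f) ⟩
    (sumTo a f + sumTo b (λ i → f (a ℕ.+ i))) + f (a ℕ.+ b) ≡⟨ +-assoc (sumTo a f) _ (f (a ℕ.+ b)) ⟩
    sumTo a f + (sumTo b (λ i → f (a ℕ.+ i)) + f (a ℕ.+ b)) ∎
    where open ≡-Reasoning

  sumTo-mono-length : ∀ {k N} (f : ℕ → ℚ) → (∀ i → 0ℚ ≤ f i) → k ℕ.≤ N → sumTo k f ≤ sumTo N f
  sumTo-mono-length {k} {N} f 0≤f k≤N = begin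
    sumTo k f                                       ≤⟨ p≤p+q (sumTo-nonNeg (N ℕ.∸ k) (λ i → 0≤f (k ℕ.+ i))) ⟩
    sumTo k f + sumTo (N ℕ.∸ k) (λ i → f (k ℕ.+ i)) ≡⟨ sym (sumTo-+ k (N ℕ.∸ k) f) ⟩
    sumTo (k ℕ.+ (N ℕ.∸ k)) f                       ≡⟨ cong (λ n → sumTo n f) (ℕ.m+[n∸m]≡n k≤N) ⟩
    sumTo N f                                       ∎
    where open ≤-Reasoning

  head≤sumTo : ∀ {N} (f : ℕ → ℚ) → (∀ i → 0ℚ ≤ f i) → 0 ℕ.< N → f 0 ≤ sumTo N f
  head≤sumTo {N} f 0≤f 0<N = subst (_≤ sumTo N f) (+-identityˡ (f 0)) (sumTo-mono-length f 0≤f 0<N)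

  sumTo-telescope : ∀ N (h t : ℕ → ℚ) → (∀ i → h i ≡ h (suc i) + t i) → sumTo N t + h N ≡ h 0
  sumTo-telescope zero    h t step = +-identityˡ (h 0)
  sumTo-telescope (suc N) h t step = begin
    (sumTo N t + t N) + h (suc N) ≡⟨ +-assoc (sumTo N t) (t N) (h (suc N)) ⟩
    sumTo N t + (t N + h (suc N)) ≡⟨ cong (_+_ (sumTo N t)) (trans (+-comm (t N) (h (suc N))) (sym (step N))) ⟩
    sumTo N t + h N               ≡⟨ sumTo-telescope N h t step ⟩
    h 0                           ∎
    where open ≡-Reasoning

  sumTo-telescope-≤ : ∀ N (h t : ℕ → ℚ) → (∀ i → h i ≡ h (suc i) + t i) → 0ℚ ≤ h N → sumTo N t ≤ h 0
  sumTo-telescope-≤ N h t step 0≤hN = subst (sumTo N t ≤_) (sumTo-telescope N h t step) (p≤p+q 0≤hN)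

  sumTo² : ℕ → (ℕ → ℕ → ℚ) → ℚ
  sumTo² N f = sumTo N (λ i → sumTo N (f i))

  sumTo²-cong : ∀ N {f g : ℕ → ℕ → ℚ} → (∀ i j → f i j ≡ g i j) → sumTo² N f ≡ sumTo² N g
  sumTo²-cong N f≡g = sumTo-cong N (λ i → sumTo-cong N (f≡g i))

  sumTo²-mono-≤ : ∀ N {f g : ℕ → ℕ → ℚ} → (∀ i j → f i j ≤ g i j) → sumTo² N f ≤ sumTo² N g
  sumTo²-mono-≤ N f≤g = sumTo-mono-≤ N (λ i _ → sumTo-mono-≤ N (λ j _ → f≤g i j))

  sumTo²-distrib-+ : ∀ N (f g : ℕ → ℕ → ℚ) →
                     sumTo² N (λ i j → f i j + g i j) ≡ sumTo² N f + sumTo² N g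
  sumTo²-distrib-+ N f g =
    trans (sumTo-cong N (λ i → sumTo-distrib-+ N (f i) (g i))) (sumTo-distrib-+ N _ _)

  sumTo²-transpose : ∀ N (f : ℕ → ℕ → ℚ) → sumTo² N (λ i j → f j i) ≡ sumTo² N f
  sumTo²-transpose N f = sumTo-comm N N (λ i j → f j i)

  sumTo-const : ∀ k d .{{_ : NonZero d}} → sumTo k (λ _ → + 1 / d) ≡ + k / d
  sumTo-const zero    d = cross≡⇒/≡ 0 1 0 d refl
  sumTo-const (suc k) d = trans (cong (_+ + 1 / d) (sumTo-const k d)) (/-suc k d)

module Harmonic where

  open import Data.Nat as ℕ using (ℕ; zero; suc; NonZero; _*_; _^_)
  import Data.Nat.Properties as ℕ
  open import Data.Nat.Tactic.RingSolver using (solve-∀)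
  open import Data.Integer as ℤ using (+_; -[1+_])
  import Data.Integer.Properties as ℤ
  open import Data.Product using (∃; _,_)
  open import Data.Rational using (ℚ; mkℚ; _/_; _≤_; _<_; _+_; ↥_)
  open import Data.Rational.Properties
  import Data.Rational.Unnormalised as ℚᵘ
  import Data.Rational.Unnormalised.Properties as ℚᵘ
  open import Relation.Binary.PropositionalEquality
  open Fraction
  open FiniteSum

  harmonic : ℕ → ℕ → ℚ
  harmonic c N = sumTo N (λ i → + 1 / (suc c * suc i))

  harmonic-block : ∀ c L .{{_ : NonZero L}} →
                   + 1 / (2 * suc c) ≤ sumTo L (λ i → + 1 / (suc c * suc (L ℕ.+ i)))
  harmonic-block c L = begin
    + 1 / (2 * C)                       ≡⟨ cross≡⇒/≡ 1 (2 * C) L (C * (2 * L)) (eq C L) ⟩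
    + L / (C * (2 * L))                 ≡⟨ sym (sumTo-const L (C * (2 * L))) ⟩
    sumTo L (λ _ → + 1 / (C * (2 * L))) ≤⟨ sumTo-mono-≤ L (λ i i<L → 1/-antimono-≤ _ _ (ℕ.*-monoʳ-≤ C (L+i<2L i<L))) ⟩
    sumTo L (λ i → + 1 / (C * suc (L ℕ.+ i))) ∎
    where
    open ≤-Reasoning
    C : ℕ
    C = suc c
    instance
      C*2L≢0 : NonZero (C * (2 * L))
      C*2L≢0 = ℕ.m*n≢0 C (2 * L) {{_}} {{ℕ.m*n≢0 2 L}}
    L+i<2L : ∀ {i} → i ℕ.< L → L ℕ.+ i ℕ.< 2 * L
    L+i<2L i<L = ℕ.≤-trans (ℕ.+-monoʳ-< L i<L) (ℕ.+-monoʳ-≤ L (ℕ.m≤m+n L 0))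
    eq : ∀ C L → 1 * (C * (2 * L)) ≡ L * (2 * C)
    eq = solve-∀

  harmonic-doubling : ∀ c k → sumTo k (λ _ → + 1 / (2 * suc c)) ≤ harmonic c (2 ^ k)
  harmonic-doubling c zero    = sumTo-nonNeg 1 (λ i → 0≤/ 1 (suc c * suc i))
  harmonic-doubling c (suc k) = begin
    sumTo k (λ _ → + 1 / (2 * suc c)) + + 1 / (2 * suc c)
      ≤⟨ +-mono-≤ (harmonic-doubling c k) (harmonic-block c L) ⟩
    harmonic c L + sumTo L (λ i → + 1 / (suc c * suc (L ℕ.+ i)))
      ≡⟨ sym (sumTo-+ L L _) ⟩
    harmonic c (L ℕ.+ L)
      ≡⟨ cong (λ n → harmonic c (L ℕ.+ n)) (sym (ℕ.+-identityʳ L)) ⟩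
    harmonic c (2 ^ suc k) ∎
    where
    open ≤-Reasoning
    L : ℕ
    L = 2 ^ k
    instance
      L≢0 : NonZero L
      L≢0 = ℕ.m^n≢0 2 k

  p<1+∣↥p∣ : ∀ p → p < + suc ℤ.∣ ↥ p ∣ / 1
  p<1+∣↥p∣ (mkℚ n d-1 _) =
    toℚᵘ-cancel-< (ℚᵘ.<-respʳ-≃ (ℚᵘ.≃-sym (toℚᵘ-/ (+ suc ℤ.∣ n ∣) 1)) (ℚᵘ.*<* (begin-strict
      n ℤ.* + 1                      ≡⟨ ℤ.*-identityʳ n ⟩
      n                              <⟨ i<1+∣i∣ n ⟩
      + suc ℤ.∣ n ∣                  ≤⟨ ℤ.+≤+ (ℕ.m≤m*n (suc ℤ.∣ n ∣) (suc d-1)) ⟩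
      + (suc ℤ.∣ n ∣ * suc d-1)      ≡⟨ ℤ.pos-* (suc ℤ.∣ n ∣) (suc d-1) ⟩
      + suc ℤ.∣ n ∣ ℤ.* + suc d-1    ∎)))
    where
    open ℤ.≤-Reasoning
    i<1+∣i∣ : ∀ i → i ℤ.< + suc ℤ.∣ i ∣
    i<1+∣i∣ (+ n)      = ℤ.+<+ (ℕ.n<1+n n)
    i<1+∣i∣ -[1+ n ]   = ℤ.-<+

  harmonic-unbounded : ∀ c B → ∃ λ N → B < harmonic c N
  harmonic-unbounded c B = 2 ^ k , (begin-strict
    B                                 <⟨ p<1+∣↥p∣ B ⟩
    + t / 1                           ≡⟨ cross≡⇒/≡ t 1 k (2 * suc c) (sym (ℕ.*-identityʳ k)) ⟩
    + k / (2 * suc c)                 ≡⟨ sym (sumTo-const k (2 * suc c)) ⟩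
    sumTo k (λ _ → + 1 / (2 * suc c)) ≤⟨ harmonic-doubling c k ⟩
    harmonic c (2 ^ k)                ∎)
    where
    open ≤-Reasoning
    t k : ℕ
    t = suc ℤ.∣ ↥ B ∣
    k = t * (2 * suc c)

module DenominatorBounds where

  open import Data.Nat
  open import Data.Nat.Properties
  open import Data.Nat.Tactic.RingSolver using (solve-∀)
  open import Data.Product using (_×_; _,_)
  open import Relation.Binary.PropositionalEquality
  open ≤-Reasoning

  m+n≢0 : ∀ m n .{{_ : NonZero m}} → NonZero (m + n)
  m+n≢0 m n = >-nonZero (<-≤-trans (>-nonZero⁻¹ m) (m≤m+n m n))

  monomial : (a b c m n : ℕ) → ℕ
  monomial a b c m n = m ^ a * n ^ b * (m + n) ^ c

  monomial-mono-≤ : ∀ {a a′ b b′ c c′} m n .{{_ : NonZero m}} .{{_ : NonZero n}} →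
                    a ≤ a′ → b ≤ b′ → c ≤ c′ → monomial a b c m n ≤ monomial a′ b′ c′ m n
  monomial-mono-≤ m n a≤a′ b≤b′ c≤c′ =
    *-mono-≤ (*-mono-≤ (^-monoʳ-≤ m a≤a′) (^-monoʳ-≤ n b≤b′)) (^-monoʳ-≤ (m + n) {{m+n≢0 m n}} c≤c′)

  monomial≤denom : ∀ s₁ s₂ s₃ s₄ m n → monomial s₁ s₂ (s₃ + s₄) m n ≤ denom s₁ s₂ s₃ s₄ m n
  monomial≤denom s₁ s₂ s₃ s₄ m n = begin
    m ^ s₁ * n ^ s₂ * (m + n) ^ (s₃ + s₄)             ≡⟨ cong (m ^ s₁ * n ^ s₂ *_) (^-distribˡ-+-* (m + n) s₃ s₄) ⟩
    m ^ s₁ * n ^ s₂ * ((m + n) ^ s₃ * (m + n) ^ s₄)   ≡⟨ *-assoc (m ^ s₁ * n ^ s₂) _ _ ⟨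
    m ^ s₁ * n ^ s₂ * (m + n) ^ s₃ * (m + n) ^ s₄     ≤⟨ *-monoʳ-≤ (m ^ s₁ * n ^ s₂ * (m + n) ^ s₃) (^-monoˡ-≤ s₄ m+n≤m+2n) ⟩
    denom s₁ s₂ s₃ s₄ m n                            ∎
    where
    m+n≤m+2n : m + n ≤ m + 2 * n
    m+n≤m+2n = +-monoʳ-≤ m (m≤n*m n 2)

  mn[m+n]≤2*monomial : ∀ a b c m n .{{_ : NonZero m}} .{{_ : NonZero n}} →
                       2 ≤ a + c → 2 ≤ b + c → 3 ≤ a + b + c →
                       m * n * (m + n) ≤ 2 * monomial a b c m n
  mn[m+n]≤2*monomial (suc a) (suc b) (suc c) m n _ _ _ = begin
    m * n * (m + n)                  ≡⟨ e m n ⟩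
    monomial 1 1 1 m n               ≤⟨ m≤n*m _ 2 ⟩
    2 * monomial 1 1 1 m n           ≤⟨ *-monoʳ-≤ 2 (monomial-mono-≤ m n (s≤s (z≤n {a})) (s≤s (z≤n {b})) (s≤s (z≤n {c}))) ⟩
    2 * monomial (suc a) (suc b) (suc c) m n ∎
    where
    e : ∀ m n → m * n * (m + n) ≡ m * 1 * (n * 1) * ((m + n) * 1)
    e = solve-∀
  mn[m+n]≤2*monomial (suc (suc a)) (suc (suc b)) zero m n _ _ _ = begin
    m * n * (m + n)                  ≤⟨ *-monoʳ-≤ (m * n) (+-mono-≤ (m≤m*n m n) (m≤n*m n m)) ⟩
    m * n * (m * n + m * n)          ≡⟨ e m n ⟩
    2 * monomial 2 2 0 m n           ≤⟨ *-monoʳ-≤ 2 (monomial-mono-≤ m n (s≤s (s≤s (z≤n {a}))) (s≤s (s≤s (z≤n {b}))) (≤-refl {0})) ⟩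
    2 * monomial (suc (suc a)) (suc (suc b)) zero m n ∎
    where
    e : ∀ m n → m * n * (m * n + m * n) ≡ 2 * (m * (m * 1) * (n * (n * 1)) * 1)
    e = solve-∀
  mn[m+n]≤2*monomial zero (suc b) (suc (suc c)) m n _ _ _ = begin
    m * n * (m + n)                  ≤⟨ *-monoˡ-≤ (m + n) (*-monoˡ-≤ n (m≤m+n m n)) ⟩
    (m + n) * n * (m + n)            ≡⟨ e m n ⟩
    monomial 0 1 2 m n               ≤⟨ m≤n*m _ 2 ⟩
    2 * monomial 0 1 2 m n           ≤⟨ *-monoʳ-≤ 2 (monomial-mono-≤ m n (≤-refl {0}) (s≤s (z≤n {b})) (s≤s (s≤s (z≤n {c})))) ⟩
    2 * monomial zero (suc b) (suc (suc c)) m n ∎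
    where
    e : ∀ m n → (m + n) * n * (m + n) ≡ 1 * (n * 1) * ((m + n) * ((m + n) * 1))
    e = solve-∀
  mn[m+n]≤2*monomial (suc a) zero (suc (suc c)) m n _ _ _ = begin
    m * n * (m + n)                  ≤⟨ *-monoˡ-≤ (m + n) (*-monoʳ-≤ m (m≤n+m n m)) ⟩
    m * (m + n) * (m + n)            ≡⟨ e m n ⟩
    monomial 1 0 2 m n               ≤⟨ m≤n*m _ 2 ⟩
    2 * monomial 1 0 2 m n           ≤⟨ *-monoʳ-≤ 2 (monomial-mono-≤ m n (s≤s (z≤n {a})) (≤-refl {0}) (s≤s (s≤s (z≤n {c})))) ⟩
    2 * monomial (suc a) zero (suc (suc c)) m n ∎
    where
    e : ∀ m n → m * (m + n) * (m + n) ≡ m * 1 * 1 * ((m + n) * ((m + n) * 1))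
    e = solve-∀
  mn[m+n]≤2*monomial zero zero (suc (suc (suc c))) m n _ _ _ = begin
    m * n * (m + n)                  ≤⟨ *-monoˡ-≤ (m + n) (*-mono-≤ (m≤m+n m n) (m≤n+m n m)) ⟩
    (m + n) * (m + n) * (m + n)      ≡⟨ e m n ⟩
    monomial 0 0 3 m n               ≤⟨ m≤n*m _ 2 ⟩
    2 * monomial 0 0 3 m n           ≤⟨ *-monoʳ-≤ 2 (monomial-mono-≤ m n (≤-refl {0}) (≤-refl {0}) (s≤s (s≤s (s≤s (z≤n {c}))))) ⟩
    2 * monomial zero zero (suc (suc (suc c))) m n ∎
    where
    e : ∀ m n → (m + n) * (m + n) * (m + n) ≡ 1 * 1 * ((m + n) * ((m + n) * ((m + n) * 1)))
    e = solve-∀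
  mn[m+n]≤2*monomial zero          b           zero                m n () _ _
  mn[m+n]≤2*monomial zero          b           (suc zero)          m n (s≤s ()) _ _
  mn[m+n]≤2*monomial (suc zero)    b           zero                m n (s≤s ()) _ _
  mn[m+n]≤2*monomial (suc (suc a)) zero        zero                m n _ () _
  mn[m+n]≤2*monomial (suc (suc a)) (suc zero)  zero                m n _ (s≤s ()) _
  mn[m+n]≤2*monomial (suc a)       zero        (suc zero)          m n _ (s≤s ()) _
  mn[m+n]≤2*monomial zero          zero        (suc (suc zero))    m n _ _ (s≤s (s≤s ()))

  ConvergenceCondition : (s₁ s₂ s₃ s₄ : ℕ) → Set
  ConvergenceCondition s₁ s₂ s₃ s₄ = (s₁ + s₃ + s₄ > 1) × (s₂ + s₃ + s₄ > 1) × (s₁ + s₂ + s₃ + s₄ > 2)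

  mn[m+n]≤2*denom : ∀ s₁ s₂ s₃ s₄ m n .{{_ : NonZero m}} .{{_ : NonZero n}} → ConvergenceCondition s₁ s₂ s₃ s₄ →
                    m * n * (m + n) ≤ 2 * denom s₁ s₂ s₃ s₄ m n
  mn[m+n]≤2*denom s₁ s₂ s₃ s₄ m n (h₁ , h₂ , h₃) = ≤-trans
    (mn[m+n]≤2*monomial s₁ s₂ (s₃ + s₄) m n
      (subst (2 ≤_) (+-assoc s₁ s₃ s₄) h₁) (subst (2 ≤_) (+-assoc s₂ s₃ s₄) h₂)
      (subst (3 ≤_) (+-assoc (s₁ + s₂) s₃ s₄) h₃))
    (*-monoʳ-≤ 2 (monomial≤denom s₁ s₂ s₃ s₄ m n))

  denom≤[m+2n]^ : ∀ s₁ s₂ s₃ s₄ m n → denom s₁ s₂ s₃ s₄ m n ≤ (m + 2 * n) ^ (s₁ + s₂ + s₃ + s₄)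
  denom≤[m+2n]^ s₁ s₂ s₃ s₄ m n = begin
    denom s₁ s₂ s₃ s₄ m n
      ≤⟨ *-monoˡ-≤ (Q ^ s₄) (*-mono-≤ (*-mono-≤ (^-monoˡ-≤ s₁ m≤Q) (^-monoˡ-≤ s₂ n≤Q)) (^-monoˡ-≤ s₃ m+n≤Q)) ⟩
    Q ^ s₁ * Q ^ s₂ * Q ^ s₃ * Q ^ s₄ ≡⟨ cong (λ x → x * Q ^ s₃ * Q ^ s₄) (^-distribˡ-+-* Q s₁ s₂) ⟨
    Q ^ (s₁ + s₂) * Q ^ s₃ * Q ^ s₄   ≡⟨ cong (_* Q ^ s₄) (^-distribˡ-+-* Q (s₁ + s₂) s₃) ⟨
    Q ^ (s₁ + s₂ + s₃) * Q ^ s₄       ≡⟨ ^-distribˡ-+-* Q (s₁ + s₂ + s₃) s₄ ⟨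
    Q ^ (s₁ + s₂ + s₃ + s₄)           ∎
    where
    Q : ℕ
    Q = m + 2 * n
    m+n≤Q : m + n ≤ Q
    m+n≤Q = +-monoʳ-≤ m (m≤n*m n 2)
    m≤Q : m ≤ Q
    m≤Q = m≤m+n m (2 * n)
    n≤Q : n ≤ Q
    n≤Q = ≤-trans (m≤n+m n m) m+n≤Q

  ^≤1⇒≤ : ∀ q k .{{_ : NonZero q}} → k ≤ 1 → q ^ k ≤ q
  ^≤1⇒≤ q k k≤1 = ≤-trans (^-monoʳ-≤ q k≤1) (≤-reflexive (*-identityʳ q))

  denom[m,1]≤3m : ∀ s₁ s₂ s₃ s₄ m .{{_ : NonZero m}} → s₁ + s₃ + s₄ ≤ 1 → denom s₁ s₂ s₃ s₄ m 1 ≤ 3 * m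
  denom[m,1]≤3m s₁ s₂ s₃ s₄ m h = begin
    denom s₁ s₂ s₃ s₄ m 1         ≡⟨ cong (λ x → m ^ s₁ * x * (m + 1) ^ s₃ * (m + 2) ^ s₄) (^-zeroˡ s₂) ⟩
    denom s₁ 0 s₃ s₄ m 1          ≤⟨ denom≤[m+2n]^ s₁ 0 s₃ s₄ m 1 ⟩
    (m + 2) ^ (s₁ + 0 + s₃ + s₄)  ≤⟨ ^≤1⇒≤ (m + 2) _ {{m+n≢0 m 2}} (subst (λ x → x + s₃ + s₄ ≤ 1) (sym (+-identityʳ s₁)) h) ⟩
    m + 2 * 1                     ≤⟨ +-monoʳ-≤ m (*-monoʳ-≤ 2 (>-nonZero⁻¹ m)) ⟩
    3 * m                         ∎

  denom[1,n]≤3n : ∀ s₁ s₂ s₃ s₄ n .{{_ : NonZero n}} → s₂ + s₃ + s₄ ≤ 1 → denom s₁ s₂ s₃ s₄ 1 n ≤ 3 * n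
  denom[1,n]≤3n s₁ s₂ s₃ s₄ n h = begin
    denom s₁ s₂ s₃ s₄ 1 n         ≡⟨ cong (λ x → x * n ^ s₂ * (1 + n) ^ s₃ * (1 + 2 * n) ^ s₄) (^-zeroˡ s₁) ⟩
    denom 0 s₂ s₃ s₄ 1 n          ≤⟨ denom≤[m+2n]^ 0 s₂ s₃ s₄ 1 n ⟩
    (1 + 2 * n) ^ (s₂ + s₃ + s₄)  ≤⟨ ^≤1⇒≤ (1 + 2 * n) _ h ⟩
    1 + 2 * n                     ≤⟨ +-monoˡ-≤ (2 * n) (>-nonZero⁻¹ n) ⟩
    3 * n                         ∎

  denom[m,n]≤9m² : ∀ s₁ s₂ s₃ s₄ m n .{{_ : NonZero m}} → n ≤ m → s₁ + s₂ + s₃ + s₄ ≤ 2 →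
                   denom s₁ s₂ s₃ s₄ m n ≤ 9 * (m * m)
  denom[m,n]≤9m² s₁ s₂ s₃ s₄ m n n≤m h = begin
    denom s₁ s₂ s₃ s₄ m n               ≤⟨ denom≤[m+2n]^ s₁ s₂ s₃ s₄ m n ⟩
    (m + 2 * n) ^ (s₁ + s₂ + s₃ + s₄)   ≤⟨ ^-monoʳ-≤ (m + 2 * n) {{m+n≢0 m (2 * n)}} h ⟩
    (m + 2 * n) ^ 2                     ≤⟨ ^-monoˡ-≤ 2 (+-monoʳ-≤ m (*-monoʳ-≤ 2 n≤m)) ⟩
    (3 * m) ^ 2                         ≡⟨ e m ⟩
    9 * (m * m)                         ∎
    where
    e : ∀ m → 3 * m * (3 * m * 1) ≡ 9 * (m * m)
    e = solve-∀

module Convergence where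

  open import Data.Nat as ℕ using (ℕ; suc; _*_)
  import Data.Nat.Properties as ℕ
  open import Data.Nat.Tactic.RingSolver using (solve-∀)
  open import Data.Integer using (+_)
  open import Data.Product using (_,_)
  open import Data.Rational using (ℚ; _/_; _≤_; _+_)
  open import Data.Rational.Properties
  open import Relation.Binary.PropositionalEquality
  open Fraction
  open FiniteSum
  open DenominatorBounds using (ConvergenceCondition; mn[m+n]≤2*denom)

  -- As in term, the indices i j stand for m = i + 1 and n = j + 1.
  mn[m+n]⁻¹ : ℕ → ℕ → ℚ
  mn[m+n]⁻¹ i j = + 1 / (suc i * suc j * (suc i ℕ.+ suc j))

  m[m+n]²⁻¹ : ℕ → ℕ → ℚ
  m[m+n]²⁻¹ i j = + 1 / (suc i * (suc i ℕ.+ suc j) * (suc i ℕ.+ suc j))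

  term≤2*mn[m+n]⁻¹ : ∀ s₁ s₂ s₃ s₄ → ConvergenceCondition s₁ s₂ s₃ s₄ →
                     ∀ i j → term s₁ s₂ s₃ s₄ i j ≤ mn[m+n]⁻¹ i j + mn[m+n]⁻¹ i j
  term≤2*mn[m+n]⁻¹ s₁ s₂ s₃ s₄ cond i j =
    1/-≤-twice (suc i * suc j * (suc i ℕ.+ suc j)) (denom s₁ s₂ s₃ s₄ (suc i) (suc j)) {{_}} {{denom≢0 s₁ s₂ s₃ s₄ i j}}
      (mn[m+n]≤2*denom s₁ s₂ s₃ s₄ (suc i) (suc j) cond)

  mn[m+n]⁻¹-partialFraction : ∀ i j → mn[m+n]⁻¹ i j ≡ m[m+n]²⁻¹ i j + m[m+n]²⁻¹ j i
  mn[m+n]⁻¹-partialFraction i j =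
    1/-partialFraction (m * n * (m ℕ.+ n)) (m * (m ℕ.+ n) * (m ℕ.+ n)) (n * (n ℕ.+ m) * (n ℕ.+ m)) (e m n)
    where
    m n : ℕ
    m = suc i
    n = suc j
    e : ∀ m n → (m * (m ℕ.+ n) * (m ℕ.+ n) ℕ.+ n * (n ℕ.+ m) * (n ℕ.+ m)) * (m * n * (m ℕ.+ n))
              ≡ m * (m ℕ.+ n) * (m ℕ.+ n) * (n * (n ℕ.+ m) * (n ℕ.+ m))
    e = solve-∀

  sumTo-1/[c[a+j][a+j+1]]≤ : ∀ c a N →
    sumTo N (λ j → + 1 / (suc c * (suc a ℕ.+ j) * (suc a ℕ.+ suc j))) ≤ + 1 / (suc c * suc a)
  sumTo-1/[c[a+j][a+j+1]]≤ c a N = subst (sumTo N t ≤_) h₀≡ (sumTo-telescope-≤ N h t step (0≤/ 1 (suc c * (suc a ℕ.+ N))))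
    where
    h t : ℕ → ℚ
    h j = + 1 / (suc c * (suc a ℕ.+ j))
    t j = + 1 / (suc c * (suc a ℕ.+ j) * (suc a ℕ.+ suc j))
    e : ∀ c a j → (c * (a ℕ.+ (1 ℕ.+ j)) ℕ.+ c * (a ℕ.+ j) * (a ℕ.+ (1 ℕ.+ j))) * (c * (a ℕ.+ j))
                  ≡ c * (a ℕ.+ (1 ℕ.+ j)) * (c * (a ℕ.+ j) * (a ℕ.+ (1 ℕ.+ j)))
    e = solve-∀
    step : ∀ j → h j ≡ h (suc j) + t j
    step j = 1/-partialFraction (suc c * (suc a ℕ.+ j)) (suc c * (suc a ℕ.+ suc j))
               (suc c * (suc a ℕ.+ j) * (suc a ℕ.+ suc j)) (e (suc c) (suc a) j)
    h₀≡ : h 0 ≡ + 1 / (suc c * suc a)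
    h₀≡ = /-cong {p₁ = + 1} {p₂ = + 1} refl (cong (suc c *_) (ℕ.+-identityʳ (suc a)))

  sumTo-m[m+n]²⁻¹≤1/m² : ∀ N i → sumTo N (m[m+n]²⁻¹ i) ≤ + 1 / (suc i * suc i)
  sumTo-m[m+n]²⁻¹≤1/m² N i = ≤-trans
    (sumTo-mono-≤ N (λ j _ → 1/-antimono-≤ (m * (m ℕ.+ suc j) * (m ℕ.+ suc j)) (m * (m ℕ.+ j) * (m ℕ.+ suc j))
      (ℕ.*-monoˡ-≤ (m ℕ.+ suc j) (ℕ.*-monoʳ-≤ m (ℕ.+-monoʳ-≤ m (ℕ.n≤1+n j))))))
    (sumTo-1/[c[a+j][a+j+1]]≤ i i N)
    where
    m : ℕ
    m = suc i

  1/m²≤2/[m[m+1]] : ∀ i → + 1 / (suc i * suc i) ≤ + 1 / (1 * suc i * suc (suc i)) + + 1 / (1 * suc i * suc (suc i))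
  1/m²≤2/[m[m+1]] i = 1/-≤-twice (1 * m * suc m) (m * m) (begin
    1 * m * suc m    ≡⟨ e m ⟩
    m * (1 ℕ.+ m)    ≤⟨ ℕ.*-monoʳ-≤ m (ℕ.+-monoˡ-≤ m (ℕ.s≤s ℕ.z≤n)) ⟩
    m * (m ℕ.+ m)    ≡⟨ f m ⟩
    2 * (m * m)      ∎)
    where
    open ℕ.≤-Reasoning
    m : ℕ
    m = suc i
    e : ∀ m → 1 * m * (1 ℕ.+ m) ≡ m * (1 ℕ.+ m)
    e = solve-∀
    f : ∀ m → m * (m ℕ.+ m) ≡ 2 * (m * m)
    f = solve-∀

  sumTo²-m[m+n]²⁻¹≤2 : ∀ N → sumTo² N m[m+n]²⁻¹ ≤ + 2 / 1
  sumTo²-m[m+n]²⁻¹≤2 N = begin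
    sumTo² N m[m+n]²⁻¹        ≤⟨ sumTo-mono-≤ N (λ i _ → ≤-trans (sumTo-m[m+n]²⁻¹≤1/m² N i) (1/m²≤2/[m[m+1]] i)) ⟩
    sumTo N (λ i → t i + t i) ≡⟨ sumTo-distrib-+ N t t ⟩
    sumTo N t + sumTo N t     ≤⟨ +-mono-≤ (sumTo-1/[c[a+j][a+j+1]]≤ 0 0 N) (sumTo-1/[c[a+j][a+j+1]]≤ 0 0 N) ⟩
    + 1 / 1 + + 1 / 1         ≡⟨⟩
    + 2 / 1                   ∎
    where
    open ≤-Reasoning
    t : ℕ → ℚ
    t i = + 1 / (1 * suc i * suc (suc i))

  sumTo²-mn[m+n]⁻¹≤4 : ∀ N → sumTo² N mn[m+n]⁻¹ ≤ + 4 / 1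
  sumTo²-mn[m+n]⁻¹≤4 N = begin
    sumTo² N mn[m+n]⁻¹                                   ≡⟨ sumTo²-cong N mn[m+n]⁻¹-partialFraction ⟩
    sumTo² N (λ i j → m[m+n]²⁻¹ i j + m[m+n]²⁻¹ j i)     ≡⟨ sumTo²-distrib-+ N m[m+n]²⁻¹ (λ i j → m[m+n]²⁻¹ j i) ⟩
    S + sumTo² N (λ i j → m[m+n]²⁻¹ j i)                 ≡⟨ cong (_+_ S) (sumTo²-transpose N m[m+n]²⁻¹) ⟩
    S + S                                                ≤⟨ +-mono-≤ (sumTo²-m[m+n]²⁻¹≤2 N) (sumTo²-m[m+n]²⁻¹≤2 N) ⟩
    + 4 / 1                                              ∎
    where
    open ≤-Reasoning
    S : ℚ
    S = sumTo² N m[m+n]²⁻¹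

  partialSum≤8 : ∀ s₁ s₂ s₃ s₄ → ConvergenceCondition s₁ s₂ s₃ s₄ → ∀ N → partialSum s₁ s₂ s₃ s₄ N ≤ + 8 / 1
  partialSum≤8 s₁ s₂ s₃ s₄ cond N = begin
    partialSum s₁ s₂ s₃ s₄ N                     ≤⟨ sumTo²-mono-≤ N (term≤2*mn[m+n]⁻¹ s₁ s₂ s₃ s₄ cond) ⟩
    sumTo² N (λ i j → mn[m+n]⁻¹ i j + mn[m+n]⁻¹ i j) ≡⟨ sumTo²-distrib-+ N mn[m+n]⁻¹ mn[m+n]⁻¹ ⟩
    sumTo² N mn[m+n]⁻¹ + sumTo² N mn[m+n]⁻¹      ≤⟨ +-mono-≤ (sumTo²-mn[m+n]⁻¹≤4 N) (sumTo²-mn[m+n]⁻¹≤4 N) ⟩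
    + 8 / 1                                      ∎
    where open ≤-Reasoning

  converges : ∀ s₁ s₂ s₃ s₄ → ConvergenceCondition s₁ s₂ s₃ s₄ → Converges s₁ s₂ s₃ s₄
  converges s₁ s₂ s₃ s₄ cond = + 8 / 1 , partialSum≤8 s₁ s₂ s₃ s₄ cond

module Divergence where

  open import Data.Nat as ℕ using (ℕ; zero; suc; NonZero; _*_; s≤s; z≤n)
  import Data.Nat.Properties as ℕ
  open import Data.Nat.Tactic.RingSolver using (solve-∀)
  open import Data.Integer using (+_)
  open import Data.Product using (_,_)
  open import Data.Rational using (_/_; _≤_; 0ℚ)
  open import Data.Rational.Properties
  open import Relation.Binary.PropositionalEquality
  open import Relation.Nullary using (¬_)
  open Fraction
  open FiniteSum
  open Harmonic
  open DenominatorBounds using (denom[m,1]≤3m; denom[1,n]≤3n; denom[m,n]≤9m²)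

  term-nonNeg : ∀ s₁ s₂ s₃ s₄ i j → 0ℚ ≤ term s₁ s₂ s₃ s₄ i j
  term-nonNeg s₁ s₂ s₃ s₄ i j = 0≤/ 1 (denom s₁ s₂ s₃ s₄ (suc i) (suc j)) {{denom≢0 s₁ s₂ s₃ s₄ i j}}

  1/≤term : ∀ s₁ s₂ s₃ s₄ i j c .{{_ : NonZero c}} →
            denom s₁ s₂ s₃ s₄ (suc i) (suc j) ℕ.≤ c → + 1 / c ≤ term s₁ s₂ s₃ s₄ i j
  1/≤term s₁ s₂ s₃ s₄ i j c {{c≢0}} =
    1/-antimono-≤ c (denom s₁ s₂ s₃ s₄ (suc i) (suc j)) {{c≢0}} {{denom≢0 s₁ s₂ s₃ s₄ i j}}

  harmonic≤⇒¬Converges : ∀ s₁ s₂ s₃ s₄ c → (∀ N → harmonic c N ≤ partialSum s₁ s₂ s₃ s₄ N) →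
                         ¬ Converges s₁ s₂ s₃ s₄
  harmonic≤⇒¬Converges s₁ s₂ s₃ s₄ c harmonic≤ (B , bounded) =
    let N , B<harmonic = harmonic-unbounded c B
    in  <-irrefl refl (<-≤-trans B<harmonic (≤-trans (harmonic≤ N) (bounded N)))

  harmonic≤partialSum-column : ∀ s₁ s₂ s₃ s₄ → s₁ ℕ.+ s₃ ℕ.+ s₄ ℕ.≤ 1 →
                               ∀ N → harmonic 2 N ≤ partialSum s₁ s₂ s₃ s₄ N
  harmonic≤partialSum-column s₁ s₂ s₃ s₄ h N = sumTo-mono-≤ N (λ i i<N → ≤-trans
    (1/≤term s₁ s₂ s₃ s₄ i 0 (3 * suc i) (denom[m,1]≤3m s₁ s₂ s₃ s₄ (suc i) h))
    (head≤sumTo (term s₁ s₂ s₃ s₄ i) (term-nonNeg s₁ s₂ s₃ s₄ i) (ℕ.≤-trans (s≤s z≤n) i<N)))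

  harmonic≤partialSum-row : ∀ s₁ s₂ s₃ s₄ → s₂ ℕ.+ s₃ ℕ.+ s₄ ℕ.≤ 1 →
                            ∀ N → harmonic 2 N ≤ partialSum s₁ s₂ s₃ s₄ N
  harmonic≤partialSum-row s₁ s₂ s₃ s₄ h zero    = ≤-refl
  harmonic≤partialSum-row s₁ s₂ s₃ s₄ h (suc N) = ≤-trans
    (sumTo-mono-≤ (suc N) (λ j _ → 1/≤term s₁ s₂ s₃ s₄ 0 j (3 * suc j) (denom[1,n]≤3n s₁ s₂ s₃ s₄ (suc j) h)))
    (head≤sumTo {suc N} (λ i → sumTo (suc N) (term s₁ s₂ s₃ s₄ i))
      (λ i → sumTo-nonNeg (suc N) (term-nonNeg s₁ s₂ s₃ s₄ i)) (s≤s z≤n))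

  harmonic≤partialSum-triangle : ∀ s₁ s₂ s₃ s₄ → s₁ ℕ.+ s₂ ℕ.+ s₃ ℕ.+ s₄ ℕ.≤ 2 →
                                 ∀ N → harmonic 8 N ≤ partialSum s₁ s₂ s₃ s₄ N
  harmonic≤partialSum-triangle s₁ s₂ s₃ s₄ h N = sumTo-mono-≤ N row≥
    where
    e : ∀ m → 1 * (9 * (m * m)) ≡ m * (9 * m)
    e = solve-∀
    row≥ : ∀ i → i ℕ.< N → + 1 / (9 * suc i) ≤ sumTo N (term s₁ s₂ s₃ s₄ i)
    row≥ i i<N = begin
      + 1 / (9 * m)                        ≡⟨ cross≡⇒/≡ 1 (9 * m) m (9 * (m * m)) (e m) ⟩
      + m / (9 * (m * m))                  ≡⟨ sumTo-const m (9 * (m * m)) ⟨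
      sumTo m (λ _ → + 1 / (9 * (m * m)))  ≤⟨ sumTo-mono-≤ m (λ j j<m →
                                                1/≤term s₁ s₂ s₃ s₄ i j _ (denom[m,n]≤9m² s₁ s₂ s₃ s₄ m (suc j) j<m h)) ⟩
      sumTo m (term s₁ s₂ s₃ s₄ i)         ≤⟨ sumTo-mono-length (term s₁ s₂ s₃ s₄ i) (term-nonNeg s₁ s₂ s₃ s₄ i) i<N ⟩
      sumTo N (term s₁ s₂ s₃ s₄ i)         ∎
      where
      open ≤-Reasoning
      m : ℕ
      m = suc i

  s₁+s₃+s₄≤1⇒¬Converges : ∀ s₁ s₂ s₃ s₄ → s₁ ℕ.+ s₃ ℕ.+ s₄ ℕ.≤ 1 → ¬ Converges s₁ s₂ s₃ s₄
  s₁+s₃+s₄≤1⇒¬Converges s₁ s₂ s₃ s₄ h =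
    harmonic≤⇒¬Converges s₁ s₂ s₃ s₄ 2 (harmonic≤partialSum-column s₁ s₂ s₃ s₄ h)

  s₂+s₃+s₄≤1⇒¬Converges : ∀ s₁ s₂ s₃ s₄ → s₂ ℕ.+ s₃ ℕ.+ s₄ ℕ.≤ 1 → ¬ Converges s₁ s₂ s₃ s₄
  s₂+s₃+s₄≤1⇒¬Converges s₁ s₂ s₃ s₄ h =
    harmonic≤⇒¬Converges s₁ s₂ s₃ s₄ 2 (harmonic≤partialSum-row s₁ s₂ s₃ s₄ h)

  s₁+s₂+s₃+s₄≤2⇒¬Converges : ∀ s₁ s₂ s₃ s₄ → s₁ ℕ.+ s₂ ℕ.+ s₃ ℕ.+ s₄ ℕ.≤ 2 → ¬ Converges s₁ s₂ s₃ s₄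
  s₁+s₂+s₃+s₄≤2⇒¬Converges s₁ s₂ s₃ s₄ h =
    harmonic≤⇒¬Converges s₁ s₂ s₃ s₄ 8 (harmonic≤partialSum-triangle s₁ s₂ s₃ s₄ h)

open import Data.Empty using (⊥-elim)
open import Data.Nat using (ℕ; _+_; _≤_; _>_; _≤?_)
open import Data.Nat.Properties using (≰⇒>)
open import Data.Product using (_×_; _,_)
open import Function.Bundles using (_⇔_; mk⇔)
open import Relation.Nullary using (¬_; yes; no)
open DenominatorBounds using (ConvergenceCondition)
open Convergence using (converges)
open Divergence using (s₁+s₃+s₄≤1⇒¬Converges; s₂+s₃+s₄≤1⇒¬Converges; s₁+s₂+s₃+s₄≤2⇒¬Converges)

>-from-contrapositive : ∀ {P : Set} k x → (x ≤ k → ¬ P) → P → x > k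
>-from-contrapositive k x x≤k⇒¬P p with x ≤? k
... | yes x≤k = ⊥-elim (x≤k⇒¬P x≤k p)
... | no  x≰k = ≰⇒> x≰k

proposition2p3 : (s₁ s₂ s₃ s₄ : ℕ) →
    Converges s₁ s₂ s₃ s₄ ⇔ ((s₁ + s₃ + s₄ > 1) × (s₂ + s₃ + s₄ > 1) × (s₁ + s₂ + s₃ + s₄ > 2))
proposition2p3 s₁ s₂ s₃ s₄ = mk⇔ necessary (converges s₁ s₂ s₃ s₄)
  where
  necessary : Converges s₁ s₂ s₃ s₄ → ConvergenceCondition s₁ s₂ s₃ s₄
  necessary conv = >-from-contrapositive 1 _ (s₁+s₃+s₄≤1⇒¬Converges s₁ s₂ s₃ s₄) conv
                 , >-from-contrapositive 1 _ (s₂+s₃+s₄≤1⇒¬Converges s₁ s₂ s₃ s₄) conv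
                 , >-from-contrapositive 2 _ (s₁+s₂+s₃+s₄≤2⇒¬Converges s₁ s₂ s₃ s₄) conv
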